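{- Let $\Gamma$ be a basis, $\Delta$ a name context, $M$ a $\lambda\mu$-term and $\delta$ a term type. If $\Gamma \vdash M : \delta \mid \Delta$ is derivable in the intersection type system described in the context, then $M$ is strongly normalising.
   Context: Pure $\lambda\mu$-calculus: given disjoint denumerable sets of term variables $x,y,\dots$ and names $\alpha,\beta,\dots$, terms are $M,N ::= x \mid \lambda x.M \mid MN \mid \mu\alpha.C$ and commands are $C ::= [\alpha]M$; $\lambda$ binds $x$ and $\mu$ binds $\alpha$; terms are taken modulo renaming of bound variables/names, with bound and free variables/names kept distinct. Structural substitution $T[\alpha\Leftarrow L]$ (for $T$ a term or command) replaces every subcommand $[\alpha]N$ by $[\alpha](N[\alpha\Leftarrow L])L$ and commutes with all other constructs. Reduction $\to$ is the compatible closure of $(\lambda x.M)N \to M[N/x]$ and $(\mu\beta.C)N \to \mu\beta.(C[\beta\Leftarrow N])$. A term is strongly normalising if it has no infinite reduction sequence. Types: with a single type constant $\nu$ and a symbol $\omega$ (which is not itself a type), term types are $\delta ::= \nu \mid \omega\to\nu \mid \kappa\to\nu \mid \delta\wedge\delta$ and stack types are $\kappa ::= \delta\times\omega \mid \delta\times\kappa \mid \kappa\wedge\kappa$. The relation $\le$ (on each sort) is the least preorder such that: $\sigma\wedge\tau\le\sigma$; $\sigma\wedge\tau\le\tau$; $\nu\le\omega\to\nu$; $\omega\to\nu\le\nu$; $\delta_1\times\delta_2\times\omega\le\delta_1\times\omega$; $(\delta_1\times\omega)\wedge(\delta_2\times\kappa)\le(\delta_1\wedge\delta_2)\times\kappa$;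 $(\delta_1\times\kappa_1)\wedge(\delta_2\times\kappa_2)\le(\delta_1\wedge\delta_2)\times(\kappa_1\wedge\kappa_2)$; if $\delta_1\le\delta_2$ then $\delta_1\times\omega\le\delta_2\times\omega$; if $\delta_1\le\delta_2$ and $\kappa_1\le\kappa_2$ then $\delta_1\times\kappa_1\le\delta_2\times\kappa_2$; if $\sigma\le\tau_1$ and $\sigma\le\tau_2$ then $\sigma\le\tau_1\wedge\tau_2$; if $\kappa_2\le\kappa_1$ then $\kappa_1\to\nu\le\kappa_2\to\nu$. A basis $\Gamma$ is a finite map from term variables to term types, a name context $\Delta$ a finite map from names to stack types (written as sets of $x{:}\delta$, $\alpha{:}\kappa$; a comma denotes disjoint extension). Typing rules for judgements $\Gamma\vdash M:\delta\mid\Delta$: (ax) $\Gamma,x{:}\delta\vdash x:\delta\mid\Delta$; (abs) from $\Gamma,x{:}\delta\vdash M:\kappa\to\nu\mid\Delta$ infer $\Gamma\vdash\lambda x.M:\delta\times\kappa\to\nu\mid\Delta$; (app) from $\Gamma\vdash M:\delta\times\kappa\to\nu\mid\Delta$ and $\Gamma\vdash N:\delta\mid\Delta$ infer $\Gamma\vdash MN:\kappa\to\nu\mid\Delta$, where in (abs) and (app) $\kappa$ is either a stack type or $\omega$; ($\mu$) from $\Gamma\vdash M:\kappa\to\nu\mid\alpha{:}\kappa,\Delta$ infer $\Gamma\vdash\mu\alpha.[\alpha]M:\kappa\to\nu\mid\Delta$, and, for $\alpha\neq\beta$, from $\Gamma\vdash M:\kappa'\to\nu\mid\alpha{:}\kappa,\beta{:}\kappa',\Delta$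 infer $\Gamma\vdash\mu\alpha.[\beta]M:\kappa\to\nu\mid\beta{:}\kappa',\Delta$; ($\le$) from $\Gamma\vdash M:\delta\mid\Delta$ and $\delta\le\delta'$ infer $\Gamma\vdash M:\delta'\mid\Delta$; ($\wedge$) from $\Gamma\vdash M:\delta\mid\Delta$ and $\Gamma\vdash M:\delta'\mid\Delta$ infer $\Gamma\vdash M:\delta\wedge\delta'\mid\Delta$. Variables in $\Gamma$ and names in $\Delta$ are never bound in $M$. -}

module Defs where

open import Data.Nat using (ℕ; zero; suc)
open import Data.Fin using (Fin; zero; suc; _≟_)
open import Data.Vec.Functional using (Vector; _∷_)
open import Data.Product using (Σ; _×_)
open import Relation.Nullary using (¬_; yes; no)
open import Relation.Binary.PropositionalEquality using (_≡_; _≢_)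

-- Term n m : terms whose free term variables are among Fin n and whose
-- free names are among Fin m.  (α-equivalence is built in; bound and
-- free variables/names are automatically distinct.)

mutual
  data Term (n m : ℕ) : Set where
    var : Fin n → Term n m
    lam : Term (suc n) m → Term n m
    app : Term n m → Term n m → Term n m
    mu  : Cmd n (suc m) → Term n m

  data Cmd (n m : ℕ) : Set where
    cmd : Fin m → Term n m → Cmd n m

mutual
  renT : ∀ {n n' m m'} → (Fin n → Fin n') → (Fin m → Fin m') → Term n m → Term n' m'
  renT ρ τ (var x)   = var (ρ x)
  renT ρ τ (lam M)   = lam (renT (liftR ρ) τ M)
  renT ρ τ (app M N) = app (renT ρ τ M) (renT ρ τ N)
  renT ρ τ (mu C)    = mu (renC ρ (liftR τ) C)

  renC : ∀ {n n' m m'} → (Fin n → Fin n') → (Fin m → Fin m') → Cmd n m → Cmd n' m'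
  renC ρ τ (cmd α M) = cmd (τ α) (renT ρ τ M)

  liftR : ∀ {k k'} → (Fin k → Fin k') → Fin (suc k) → Fin (suc k')
  liftR ρ zero    = zero
  liftR ρ (suc i) = suc (ρ i)

wkV : ∀ {n m} → Term n m → Term (suc n) m
wkV = renT suc (λ α → α)

wkN : ∀ {n m} → Term n m → Term n (suc m)
wkN = renT (λ x → x) suc

liftS : ∀ {n n' m} → (Fin n → Term n' m) → Fin (suc n) → Term (suc n') m
liftS σ zero    = var zero
liftS σ (suc x) = wkV (σ x)

mutual
  subT : ∀ {n n' m} → (Fin n → Term n' m) → Term n m → Term n' m
  subT σ (var x)   = σ x
  subT σ (lam M)   = lam (subT (liftS σ) M)
  subT σ (app M N) = app (subT σ M) (subT σ N)
  subT σ (mu C)    = mu (subC (λ x → wkN (σ x)) C)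

  subC : ∀ {n n' m} → (Fin n → Term n' m) → Cmd n m → Cmd n' m
  subC σ (cmd α M) = cmd α (subT σ M)

_[_/0] : ∀ {n m} → Term (suc n) m → Term n m → Term n m
M [ N /0] = subT (N ∷ var) M

mutual
  ssubT : ∀ {n m} → Fin m → Term n m → Term n m → Term n m
  ssubT α L (var x)   = var x
  ssubT α L (lam M)   = lam (ssubT α (wkV L) M)
  ssubT α L (app M N) = app (ssubT α L M) (ssubT α L N)
  ssubT α L (mu C)    = mu (ssubC (suc α) (wkN L) C)

  ssubC : ∀ {n m} → Fin m → Term n m → Cmd n m → Cmd n m
  ssubC α L (cmd β M) with β ≟ α
  ... | yes _ = cmd β (app (ssubT α L M) L)
  ... | no  _ = cmd β (ssubT α L M)

mutual
  data _⟶_ {n m : ℕ} : Term n m → Term n m → Set where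
    β-red : ∀ {M N} → app (lam M) N ⟶ (M [ N /0])
    μ-red : ∀ {C N} → app (mu C) N ⟶ mu (ssubC zero (wkN N) C)
    ξ-lam : ∀ {M M'} → M ⟶ M' → lam M ⟶ lam M'
    ξ-appˡ : ∀ {M M' N} → M ⟶ M' → app M N ⟶ app M' N
    ξ-appʳ : ∀ {M N N'} → N ⟶ N' → app M N ⟶ app M N'
    ξ-mu  : ∀ {C C'} → C ⟶ᶜ C' → mu C ⟶ mu C'

  data _⟶ᶜ_ {n m : ℕ} : Cmd n m → Cmd n m → Set where
    ξ-cmd : ∀ {α M M'} → M ⟶ M' → cmd α M ⟶ᶜ cmd α M'

SN : ∀ {n m} → Term n m → Set
SN {n} {m} M =
  ¬ Σ (ℕ → Term n m) (λ f → (f 0 ≡ M) × (∀ i → f i ⟶ f (suc i)))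

infixr 6 _∧_ _∧ˢ_

mutual
  data TType : Set where
    ν    : TType
    ω⇒ν  : TType
    _⇒ν  : SType → TType
    _∧_  : TType → TType → TType

  data SType : Set where
    _×ω  : TType → SType
    _×ˢ_ : TType → SType → SType
    _∧ˢ_ : SType → SType → SType

-- "κ is either a stack type or ω"
data Tail : Set where
  ω   : Tail
  stk : SType → Tail

arr : Tail → TType
arr ω       = ω⇒ν
arr (stk κ) = κ ⇒ν

pair : TType → Tail → SType
pair δ ω       = δ ×ω
pair δ (stk κ) = δ ×ˢ κ

mutual
  data _≤ᵗ_ : TType → TType → Set where
    refl  : ∀ {δ} → δ ≤ᵗ δ
    trans : ∀ {a b c} → a ≤ᵗ b → b ≤ᵗ c → a ≤ᵗ c
    ∧-l   : ∀ {a b} → (a ∧ b) ≤ᵗ a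
    ∧-r   : ∀ {a b} → (a ∧ b) ≤ᵗ b
    ν≤ων  : ν ≤ᵗ ω⇒ν
    ων≤ν  : ω⇒ν ≤ᵗ ν
    glb   : ∀ {s t₁ t₂} → s ≤ᵗ t₁ → s ≤ᵗ t₂ → s ≤ᵗ (t₁ ∧ t₂)
    contra : ∀ {κ₁ κ₂} → κ₂ ≤ˢ κ₁ → (κ₁ ⇒ν) ≤ᵗ (κ₂ ⇒ν)

  data _≤ˢ_ : SType → SType → Set where
    refl  : ∀ {κ} → κ ≤ˢ κ
    trans : ∀ {a b c} → a ≤ˢ b → b ≤ˢ c → a ≤ˢ c
    ∧-l   : ∀ {a b} → (a ∧ˢ b) ≤ˢ a
    ∧-r   : ∀ {a b} → (a ∧ˢ b) ≤ˢ b
    drop  : ∀ {δ₁ δ₂} → (δ₁ ×ˢ (δ₂ ×ω)) ≤ˢ (δ₁ ×ω)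
    dist-ω : ∀ {δ₁ δ₂ κ} → ((δ₁ ×ω) ∧ˢ (δ₂ ×ˢ κ)) ≤ˢ ((δ₁ ∧ δ₂) ×ˢ κ)
    dist  : ∀ {δ₁ δ₂ κ₁ κ₂} →
            ((δ₁ ×ˢ κ₁) ∧ˢ (δ₂ ×ˢ κ₂)) ≤ˢ ((δ₁ ∧ δ₂) ×ˢ (κ₁ ∧ˢ κ₂))
    mono-ω : ∀ {δ₁ δ₂} → δ₁ ≤ᵗ δ₂ → (δ₁ ×ω) ≤ˢ (δ₂ ×ω)
    mono  : ∀ {δ₁ δ₂ κ₁ κ₂} → δ₁ ≤ᵗ δ₂ → κ₁ ≤ˢ κ₂ → (δ₁ ×ˢ κ₁) ≤ˢ (δ₂ ×ˢ κ₂)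
    glb   : ∀ {s t₁ t₂} → s ≤ˢ t₁ → s ≤ˢ t₂ → s ≤ˢ (t₁ ∧ˢ t₂)

-- Typing  Γ ⊢ M ∶ δ ∣ Δ
-- Γ : basis on the term-variable scope, Δ : name context on the name scope.
-- Extension by a fresh bound variable/name at index 0 is  δ ∷ Γ / κ ∷ Δ.

data _⊢_∶_∣_ {n m : ℕ} (Γ : Vector TType n) :
       Term n m → TType → Vector SType m → Set where
  ax   : ∀ {Δ x} → Γ ⊢ var x ∶ Γ x ∣ Δ
  abs  : ∀ {Δ M δ} (κ : Tail) →
         (δ ∷ Γ) ⊢ M ∶ arr κ ∣ Δ →
         Γ ⊢ lam M ∶ (pair δ κ ⇒ν) ∣ Δ
  appT : ∀ {Δ M N δ} (κ : Tail) →
         Γ ⊢ M ∶ (pair δ κ ⇒ν) ∣ Δ → Γ ⊢ N ∶ δ ∣ Δ →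
         Γ ⊢ app M N ∶ arr κ ∣ Δ
  μ-same : ∀ {Δ κ M} →
         Γ ⊢ M ∶ (κ ⇒ν) ∣ (κ ∷ Δ) →
         Γ ⊢ mu (cmd zero M) ∶ (κ ⇒ν) ∣ Δ
  μ-diff : ∀ {Δ κ M} (β : Fin m) →
         Γ ⊢ M ∶ (Δ β ⇒ν) ∣ (κ ∷ Δ) →
         Γ ⊢ mu (cmd (suc β) M) ∶ (κ ⇒ν) ∣ Δ
  sub  : ∀ {Δ M δ δ'} → Γ ⊢ M ∶ δ ∣ Δ → δ ≤ᵗ δ' → Γ ⊢ M ∶ δ' ∣ Δ
  int  : ∀ {Δ M δ δ'} → Γ ⊢ M ∶ δ ∣ Δ → Γ ⊢ M ∶ δ' ∣ Δ → Γ ⊢ M ∶ (δ ∧ δ') ∣ Δ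

-- A type δ denotes a set ⟦ δ ⟧ of strongly normalising terms:
-- κ → ν denotes the terms that are strongly normalising in front of every stack of ⟦ κ ⟧ˢ,
-- and the stack types denote lists of reducible arguments.  Subtyping is sound for this
-- interpretation, and the μ rule is handled by expanding (μα.C) N₁ … Nₖ to μα.C[α ⇐ N₁ … Nₖ]:
-- both β and μ head redexes are strongly normalising as soon as their contractum and
-- argument are.  The fundamental lemma is proved for a simultaneous substitution that also
-- appends stacks to named commands; instantiating variables by themselves and names by
-- stacks of fresh variables shows every typable term strongly normalising.

module Submission where

open import Defs
open import Data.Nat using (ℕ; zero; suc; _≤_; _⊔_; s≤s)
open import Data.Nat.Properties using (≤-refl; m⊔n≤o⇒m≤o; m⊔n≤o⇒n≤o)
open import Data.Fin using (Fin; zero; suc; _≟_)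
open import Data.Fin.Properties using (suc-injective)
open import Data.Vec.Functional using (Vector) renaming (_∷_ to _∷ᵛ_)
open import Data.List using (List; []; _∷_; [_]; map; _++_; replicate)
open import Data.List.Properties using (map-∘; map-cong; map-++; map-id; ++-identityʳ)
open import Data.List.Relation.Unary.All as All using (All; []; _∷_)
import Data.List.Relation.Unary.All.Properties as Allₚ
open import Data.List.Relation.Binary.Pointwise as Pointwise using (Pointwise; []; _∷_)
open import Data.Product using (_×_; _,_; proj₁)
open import Data.Empty using (⊥; ⊥-elim)
open import Function using (_∘_; id; const; flip)
open import Function.Bundles using (_⇔_; mk⇔; module Equivalence)
open import Induction.WellFounded using (Acc; acc; module Subrelation)
import Relation.Binary.Construct.On as On
open import Relation.Binary.Construct.Closure.ReflexiveTransitive using (Star; ε; _◅_; _◅◅_; gmap)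
open import Relation.Binary.PropositionalEquality as ≡
  using (_≡_; refl; sym; cong; cong₂; subst; subst₂; _≗_; module ≡-Reasoning)
open import Relation.Nullary using (yes; no)

variable
  n m n' m' n'' m'' : ℕ

infixl 5 _·_

_·_ : Term n m → List (Term n m) → Term n m
H · []      = H
H · (N ∷ S) = app H N · S

·-++ : (H : Term n m) (S S' : List (Term n m)) → H · (S ++ S') ≡ H · S · S'
·-++ H []      S' = refl
·-++ H (N ∷ S) S' = ·-++ (app H N) S S'

renT-· : (ρ : Fin n → Fin n') (τ : Fin m → Fin m') (H : Term n m) (S : List (Term n m)) →
         renT ρ τ (H · S) ≡ renT ρ τ H · map (renT ρ τ) S
renT-· ρ τ H []      = refl
renT-· ρ τ H (N ∷ S) = renT-· ρ τ (app H N) S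

map-commute : {A B C D : Set} {f : B → D} {g : A → B} {h : C → D} {k : A → C} →
              (∀ x → f (g x) ≡ h (k x)) → ∀ xs → map f (map g xs) ≡ map h (map k xs)
map-commute e xs = ≡.trans (sym (map-∘ xs)) (≡.trans (map-cong e xs) (map-∘ xs))

map-commute-++ : {A B C D : Set} {f : B → D} {g : A → B} {h : C → D} {k : A → C} →
                 (∀ x → f (g x) ≡ h (k x)) →
                 ∀ xs ys → map f (map g xs) ++ map h ys ≡ map h (map k xs ++ ys)
map-commute-++ {h = h} {k} e xs ys =
  ≡.trans (cong (_++ map h ys) (map-commute e xs)) (sym (map-++ h (map k xs) ys))

-- A λμ-substitution replaces term variables by terms, renames names, and appends the stack
-- `stacks α` to the body of every command [α]P: a structural substitution of whole stacks.
record Sub (n m n' m' : ℕ) : Set where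
  constructor ⟪_,_,_⟫
  field
    terms  : Fin n → Term n' m'
    names  : Fin m → Fin m'
    stacks : Fin m → List (Term n' m')

open Sub

infix 4 _≐_

_≐_ : Sub n m n' m' → Sub n m n' m' → Set
s ≐ t = terms s ≗ terms t × names s ≗ names t × stacks s ≗ stacks t

infixr 9 _∷ᵗ_ _∷ⁿ_

_∷ᵗ_ : Term n' m' → Sub n m n' m' → Sub (suc n) m n' m'
N ∷ᵗ s = ⟪ N ∷ᵛ terms s , names s , stacks s ⟫

_∷ⁿ_ : List (Term n' m') → Sub n m n' m' → Sub n (suc m) n' (suc m')
S ∷ⁿ s = ⟪ wkN ∘ terms s , liftR (names s) , map wkN ∘ (S ∷ᵛ stacks s) ⟫

⇑ᵛ : Sub n m n' m' → Sub (suc n) m (suc n') m'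
⇑ᵛ s = ⟪ liftS (terms s) , names s , map wkV ∘ stacks s ⟫

⇑ⁿ : Sub n m n' m' → Sub n (suc m) n' (suc m')
⇑ⁿ s = [] ∷ⁿ s

infixr 8 _⋆_ _⋆ᶜ_

mutual
  _⋆_ : Sub n m n' m' → Term n m → Term n' m'
  s ⋆ var x   = terms s x
  s ⋆ lam M   = lam (⇑ᵛ s ⋆ M)
  s ⋆ app M N = app (s ⋆ M) (s ⋆ N)
  s ⋆ mu C    = mu (⇑ⁿ s ⋆ᶜ C)

  _⋆ᶜ_ : Sub n m n' m' → Cmd n m → Cmd n' m'
  s ⋆ᶜ cmd α M = cmd (names s α) (s ⋆ M · stacks s α)

ids : Sub n m n m
ids = ⟪ var , id , const [] ⟫

ren : (Fin n → Fin n') → (Fin m → Fin m') → Sub n m n' m'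
ren ρ τ = ⟪ var ∘ ρ , τ , const [] ⟫

_/0 : Term n m → Sub (suc n) m n m
N /0 = N ∷ᵗ ids

_↦_ : {A : Set} → Fin m → List A → Fin m → List A
(α ↦ S) β with β ≟ α
... | yes _ = S
... | no  _ = []

_⇐_ : Fin m → List (Term n m) → Sub n m n m
α ⇐ S = ⟪ var , id , α ↦ S ⟫

⟨_,_⟩∘_ : (Fin n' → Fin n'') → (Fin m' → Fin m'') → Sub n m n' m' → Sub n m n'' m''
⟨ ρ , τ ⟩∘ s = ⟪ renT ρ τ ∘ terms s , τ ∘ names s , map (renT ρ τ) ∘ stacks s ⟫

_∘⟨_,_⟩ : Sub n' m' n'' m'' → (Fin n → Fin n') → (Fin m → Fin m') → Sub n m n'' m''
s ∘⟨ ρ , τ ⟩ = ⟪ terms s ∘ ρ , names s ∘ τ , stacks s ∘ τ ⟫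

infixr 9 _⊙_

_⊙_ : Sub n' m' n'' m'' → Sub n m n' m' → Sub n m n'' m''
t ⊙ s = ⟪ (t ⋆_) ∘ terms s , names t ∘ names s ,
          (λ α → map (t ⋆_) (stacks s α) ++ stacks t (names s α)) ⟫

liftR-cong : {ρ ρ' : Fin n → Fin n'} → ρ ≗ ρ' → liftR ρ ≗ liftR ρ'
liftR-cong e zero    = refl
liftR-cong e (suc i) = cong suc (e i)

liftR-∘ : (ρ₂ : Fin n' → Fin n'') (ρ₁ : Fin n → Fin n') → liftR ρ₂ ∘ liftR ρ₁ ≗ liftR (ρ₂ ∘ ρ₁)
liftR-∘ ρ₂ ρ₁ zero    = refl
liftR-∘ ρ₂ ρ₁ (suc i) = refl

liftR-id : liftR {n} id ≗ id
liftR-id zero    = refl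
liftR-id (suc i) = refl

liftS-cong : {σ σ' : Fin n → Term n' m} → σ ≗ σ' → liftS σ ≗ liftS σ'
liftS-cong e zero    = refl
liftS-cong e (suc x) = cong wkV (e x)

⇑ᵛ-cong : {s t : Sub n m n' m'} → s ≐ t → ⇑ᵛ s ≐ ⇑ᵛ t
⇑ᵛ-cong (eᵗ , eⁿ , eˢ) = liftS-cong eᵗ , eⁿ , cong (map wkV) ∘ eˢ

⇑ⁿ-cong : {s t : Sub n m n' m'} → s ≐ t → ⇑ⁿ s ≐ ⇑ⁿ t
⇑ⁿ-cong (eᵗ , eⁿ , eˢ) =
  cong wkN ∘ eᵗ , liftR-cong eⁿ , λ { zero → refl ; (suc α) → cong (map wkN) (eˢ α) }

mutual
  ⋆-cong : {s t : Sub n m n' m'} → s ≐ t → (M : Term n m) → s ⋆ M ≡ t ⋆ M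
  ⋆-cong (eᵗ , _ , _) (var x) = eᵗ x
  ⋆-cong e (lam M)   = cong lam (⋆-cong (⇑ᵛ-cong e) M)
  ⋆-cong e (app M N) = cong₂ app (⋆-cong e M) (⋆-cong e N)
  ⋆-cong e (mu C)    = cong mu (⋆ᶜ-cong (⇑ⁿ-cong e) C)

  ⋆ᶜ-cong : {s t : Sub n m n' m'} → s ≐ t → (C : Cmd n m) → s ⋆ᶜ C ≡ t ⋆ᶜ C
  ⋆ᶜ-cong e@(_ , eⁿ , eˢ) (cmd α M) = cong₂ cmd (eⁿ α) (cong₂ _·_ (⋆-cong e M) (eˢ α))

⋆-· : (s : Sub n m n' m') (H : Term n m) (S : List (Term n m)) → s ⋆ (H · S) ≡ s ⋆ H · map (s ⋆_) S
⋆-· s H []      = refl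
⋆-· s H (N ∷ S) = ⋆-· s (app H N) S

⇑ᵛ-∘⟨⟩ : (s : Sub n' m' n'' m'') (ρ : Fin n → Fin n') (τ : Fin m → Fin m') →
         ⇑ᵛ s ∘⟨ liftR ρ , τ ⟩ ≐ ⇑ᵛ (s ∘⟨ ρ , τ ⟩)
⇑ᵛ-∘⟨⟩ s ρ τ = (λ { zero → refl ; (suc x) → refl }) , (λ _ → refl) , (λ _ → refl)

⇑ⁿ-∘⟨⟩ : (s : Sub n' m' n'' m'') (ρ : Fin n → Fin n') (τ : Fin m → Fin m') →
         ⇑ⁿ s ∘⟨ ρ , liftR τ ⟩ ≐ ⇑ⁿ (s ∘⟨ ρ , τ ⟩)
⇑ⁿ-∘⟨⟩ s ρ τ = (λ _ → refl) , liftR-∘ (names s) τ , λ { zero → refl ; (suc α) → refl }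

mutual
  ⋆-renT : (s : Sub n' m' n'' m'') (ρ : Fin n → Fin n') (τ : Fin m → Fin m') (M : Term n m) →
           s ⋆ renT ρ τ M ≡ s ∘⟨ ρ , τ ⟩ ⋆ M
  ⋆-renT s ρ τ (var x)   = refl
  ⋆-renT s ρ τ (lam M)   =
    cong lam (≡.trans (⋆-renT (⇑ᵛ s) (liftR ρ) τ M) (⋆-cong (⇑ᵛ-∘⟨⟩ s ρ τ) M))
  ⋆-renT s ρ τ (app M N) = cong₂ app (⋆-renT s ρ τ M) (⋆-renT s ρ τ N)
  ⋆-renT s ρ τ (mu C)    =
    cong mu (≡.trans (⋆ᶜ-renC (⇑ⁿ s) ρ (liftR τ) C) (⋆ᶜ-cong (⇑ⁿ-∘⟨⟩ s ρ τ) C))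

  ⋆ᶜ-renC : (s : Sub n' m' n'' m'') (ρ : Fin n → Fin n') (τ : Fin m → Fin m') (C : Cmd n m) →
            s ⋆ᶜ renC ρ τ C ≡ s ∘⟨ ρ , τ ⟩ ⋆ᶜ C
  ⋆ᶜ-renC s ρ τ (cmd α M) = cong (λ P → cmd (names s (τ α)) (P · stacks s (τ α))) (⋆-renT s ρ τ M)

ren-⇑ᵛ : (ρ : Fin n → Fin n') (τ : Fin m → Fin m') → ren (liftR ρ) τ ≐ ⇑ᵛ (ren ρ τ)
ren-⇑ᵛ ρ τ = (λ { zero → refl ; (suc x) → refl }) , (λ _ → refl) , (λ _ → refl)

ren-⇑ⁿ : (ρ : Fin n → Fin n') (τ : Fin m → Fin m') → ren ρ (liftR τ) ≐ ⇑ⁿ (ren ρ τ)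
ren-⇑ⁿ ρ τ = (λ _ → refl) , (λ _ → refl) , λ { zero → refl ; (suc α) → refl }

mutual
  renT-as-⋆ : (ρ : Fin n → Fin n') (τ : Fin m → Fin m') (M : Term n m) → renT ρ τ M ≡ ren ρ τ ⋆ M
  renT-as-⋆ ρ τ (var x)   = refl
  renT-as-⋆ ρ τ (lam M)   = cong lam (≡.trans (renT-as-⋆ (liftR ρ) τ M) (⋆-cong (ren-⇑ᵛ ρ τ) M))
  renT-as-⋆ ρ τ (app M N) = cong₂ app (renT-as-⋆ ρ τ M) (renT-as-⋆ ρ τ N)
  renT-as-⋆ ρ τ (mu C)    = cong mu (≡.trans (renC-as-⋆ᶜ ρ (liftR τ) C) (⋆ᶜ-cong (ren-⇑ⁿ ρ τ) C))

  renC-as-⋆ᶜ : (ρ : Fin n → Fin n') (τ : Fin m → Fin m') (C : Cmd n m) → renC ρ τ C ≡ ren ρ τ ⋆ᶜ C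
  renC-as-⋆ᶜ ρ τ (cmd α M) = cong (cmd (τ α)) (renT-as-⋆ ρ τ M)

ids-⇑ᵛ : ⇑ᵛ (ids {n} {m}) ≐ ids
ids-⇑ᵛ = (λ { zero → refl ; (suc x) → refl }) , (λ _ → refl) , (λ _ → refl)

ids-⇑ⁿ : ⇑ⁿ (ids {n} {m}) ≐ ids
ids-⇑ⁿ = (λ _ → refl) , liftR-id , λ { zero → refl ; (suc α) → refl }

mutual
  ids-⋆ : (M : Term n m) → ids ⋆ M ≡ M
  ids-⋆ (var x)   = refl
  ids-⋆ (lam M)   = cong lam (≡.trans (⋆-cong ids-⇑ᵛ M) (ids-⋆ M))
  ids-⋆ (app M N) = cong₂ app (ids-⋆ M) (ids-⋆ N)
  ids-⋆ (mu C)    = cong mu (≡.trans (⋆ᶜ-cong ids-⇑ⁿ C) (ids-⋆ᶜ C))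

  ids-⋆ᶜ : (C : Cmd n m) → ids ⋆ᶜ C ≡ C
  ids-⋆ᶜ (cmd α M) = cong (cmd α) (ids-⋆ M)

renT-id : (M : Term n m) → renT id id M ≡ M
renT-id M = ≡.trans (renT-as-⋆ id id M) (ids-⋆ M)

renT-renT : (ρ₂ : Fin n' → Fin n'') (τ₂ : Fin m' → Fin m'') (ρ₁ : Fin n → Fin n') (τ₁ : Fin m → Fin m')
            (M : Term n m) → renT ρ₂ τ₂ (renT ρ₁ τ₁ M) ≡ renT (ρ₂ ∘ ρ₁) (τ₂ ∘ τ₁) M
renT-renT ρ₂ τ₂ ρ₁ τ₁ M = begin
  renT ρ₂ τ₂ (renT ρ₁ τ₁ M)          ≡⟨ renT-as-⋆ ρ₂ τ₂ (renT ρ₁ τ₁ M) ⟩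
  ren ρ₂ τ₂ ⋆ renT ρ₁ τ₁ M           ≡⟨ ⋆-renT (ren ρ₂ τ₂) ρ₁ τ₁ M ⟩
  ren (ρ₂ ∘ ρ₁) (τ₂ ∘ τ₁) ⋆ M        ≡⟨ renT-as-⋆ (ρ₂ ∘ ρ₁) (τ₂ ∘ τ₁) M ⟨
  renT (ρ₂ ∘ ρ₁) (τ₂ ∘ τ₁) M         ∎
  where open ≡-Reasoning

renT-wkV : (ρ : Fin n → Fin n') (τ : Fin m → Fin m') (M : Term n m) →
           renT (liftR ρ) τ (wkV M) ≡ wkV (renT ρ τ M)
renT-wkV ρ τ M = ≡.trans (renT-renT (liftR ρ) τ suc id M) (sym (renT-renT suc id ρ τ M))

renT-wkN : (ρ : Fin n → Fin n') (τ : Fin m → Fin m') (M : Term n m) →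
           renT ρ (liftR τ) (wkN M) ≡ wkN (renT ρ τ M)
renT-wkN ρ τ M = ≡.trans (renT-renT ρ (liftR τ) id suc M) (sym (renT-renT id suc ρ τ M))

⟨⟩∘-⇑ᵛ : (ρ : Fin n' → Fin n'') (τ : Fin m' → Fin m'') (s : Sub n m n' m') →
         ⟨ liftR ρ , τ ⟩∘ ⇑ᵛ s ≐ ⇑ᵛ (⟨ ρ , τ ⟩∘ s)
⟨⟩∘-⇑ᵛ ρ τ s =
  (λ { zero → refl ; (suc x) → renT-wkV ρ τ (terms s x) }) ,
  (λ _ → refl) ,
  (λ α → map-commute (renT-wkV ρ τ) (stacks s α))

⟨⟩∘-⇑ⁿ : (ρ : Fin n' → Fin n'') (τ : Fin m' → Fin m'') (s : Sub n m n' m') →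
         ⟨ ρ , liftR τ ⟩∘ ⇑ⁿ s ≐ ⇑ⁿ (⟨ ρ , τ ⟩∘ s)
⟨⟩∘-⇑ⁿ ρ τ s =
  renT-wkN ρ τ ∘ terms s ,
  liftR-∘ τ (names s) ,
  λ { zero → refl ; (suc α) → map-commute (renT-wkN ρ τ) (stacks s α) }

mutual
  renT-⋆ : (ρ : Fin n' → Fin n'') (τ : Fin m' → Fin m'') (s : Sub n m n' m') (M : Term n m) →
           renT ρ τ (s ⋆ M) ≡ ⟨ ρ , τ ⟩∘ s ⋆ M
  renT-⋆ ρ τ s (var x)   = refl
  renT-⋆ ρ τ s (lam M)   =
    cong lam (≡.trans (renT-⋆ (liftR ρ) τ (⇑ᵛ s) M) (⋆-cong (⟨⟩∘-⇑ᵛ ρ τ s) M))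
  renT-⋆ ρ τ s (app M N) = cong₂ app (renT-⋆ ρ τ s M) (renT-⋆ ρ τ s N)
  renT-⋆ ρ τ s (mu C)    =
    cong mu (≡.trans (renC-⋆ᶜ ρ (liftR τ) (⇑ⁿ s) C) (⋆ᶜ-cong (⟨⟩∘-⇑ⁿ ρ τ s) C))

  renC-⋆ᶜ : (ρ : Fin n' → Fin n'') (τ : Fin m' → Fin m'') (s : Sub n m n' m') (C : Cmd n m) →
            renC ρ τ (s ⋆ᶜ C) ≡ ⟨ ρ , τ ⟩∘ s ⋆ᶜ C
  renC-⋆ᶜ ρ τ s (cmd α M) =
    cong (cmd (τ (names s α)))
      (≡.trans (renT-· ρ τ (s ⋆ M) (stacks s α))
               (cong (_· map (renT ρ τ) (stacks s α)) (renT-⋆ ρ τ s M)))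

⇑ᵛ-wkV : (s : Sub n m n' m') (M : Term n m) → ⇑ᵛ s ⋆ wkV M ≡ wkV (s ⋆ M)
⇑ᵛ-wkV s M = ≡.trans (⋆-renT (⇑ᵛ s) suc id M) (sym (renT-⋆ suc id s M))

⇑ⁿ-wkN : (s : Sub n m n' m') (M : Term n m) → ⇑ⁿ s ⋆ wkN M ≡ wkN (s ⋆ M)
⇑ⁿ-wkN s M = ≡.trans (⋆-renT (⇑ⁿ s) id suc M) (sym (renT-⋆ id suc s M))

⇑ᵛ-⊙ : (t : Sub n' m' n'' m'') (s : Sub n m n' m') → ⇑ᵛ t ⊙ ⇑ᵛ s ≐ ⇑ᵛ (t ⊙ s)
⇑ᵛ-⊙ t s =
  (λ { zero → refl ; (suc x) → ⇑ᵛ-wkV t (terms s x) }) ,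
  (λ _ → refl) ,
  (λ α → map-commute-++ (⇑ᵛ-wkV t) (stacks s α) (stacks t (names s α)))

⇑ⁿ-⊙ : (t : Sub n' m' n'' m'') (s : Sub n m n' m') → ⇑ⁿ t ⊙ ⇑ⁿ s ≐ ⇑ⁿ (t ⊙ s)
⇑ⁿ-⊙ t s =
  ⇑ⁿ-wkN t ∘ terms s ,
  liftR-∘ (names t) (names s) ,
  λ { zero → refl ; (suc α) → map-commute-++ (⇑ⁿ-wkN t) (stacks s α) (stacks t (names s α)) }

mutual
  ⋆-⋆ : (t : Sub n' m' n'' m'') (s : Sub n m n' m') (M : Term n m) → t ⋆ s ⋆ M ≡ t ⊙ s ⋆ M
  ⋆-⋆ t s (var x)   = refl
  ⋆-⋆ t s (lam M)   = cong lam (≡.trans (⋆-⋆ (⇑ᵛ t) (⇑ᵛ s) M) (⋆-cong (⇑ᵛ-⊙ t s) M))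
  ⋆-⋆ t s (app M N) = cong₂ app (⋆-⋆ t s M) (⋆-⋆ t s N)
  ⋆-⋆ t s (mu C)    = cong mu (≡.trans (⋆ᶜ-⋆ᶜ (⇑ⁿ t) (⇑ⁿ s) C) (⋆ᶜ-cong (⇑ⁿ-⊙ t s) C))

  ⋆ᶜ-⋆ᶜ : (t : Sub n' m' n'' m'') (s : Sub n m n' m') (C : Cmd n m) → t ⋆ᶜ s ⋆ᶜ C ≡ t ⊙ s ⋆ᶜ C
  ⋆ᶜ-⋆ᶜ t s (cmd α M) = cong (cmd (names t (names s α))) (begin
    t ⋆ (s ⋆ M · S₁) · S₂               ≡⟨ cong (_· S₂) (⋆-· t (s ⋆ M) S₁) ⟩
    t ⋆ s ⋆ M · map (t ⋆_) S₁ · S₂      ≡⟨ ·-++ (t ⋆ s ⋆ M) (map (t ⋆_) S₁) S₂ ⟨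
    t ⋆ s ⋆ M · (map (t ⋆_) S₁ ++ S₂)   ≡⟨ cong (_· (map (t ⋆_) S₁ ++ S₂)) (⋆-⋆ t s M) ⟩
    t ⊙ s ⋆ M · (map (t ⋆_) S₁ ++ S₂)   ∎)
    where
      open ≡-Reasoning
      S₁ = stacks s α
      S₂ = stacks t (names s α)

mutual
  subT-as-⋆ : (σ : Fin n → Term n' m) (M : Term n m) → subT σ M ≡ ⟪ σ , id , const [] ⟫ ⋆ M
  subT-as-⋆ σ (var x)   = refl
  subT-as-⋆ σ (lam M)   = cong lam (subT-as-⋆ (liftS σ) M)
  subT-as-⋆ σ (app M N) = cong₂ app (subT-as-⋆ σ M) (subT-as-⋆ σ N)
  subT-as-⋆ σ (mu C)    =
    cong mu (≡.trans (subC-as-⋆ᶜ (wkN ∘ σ) C)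
                     (⋆ᶜ-cong ((λ _ → refl) , (λ α → sym (liftR-id α)) ,
                               λ { zero → refl ; (suc α) → refl }) C))

  subC-as-⋆ᶜ : (σ : Fin n → Term n' m) (C : Cmd n m) → subC σ C ≡ ⟪ σ , id , const [] ⟫ ⋆ᶜ C
  subC-as-⋆ᶜ σ (cmd α M) = cong (cmd α) (subT-as-⋆ σ M)

[/0]-as-⋆ : (M : Term (suc n) m) (N : Term n m) → M [ N /0] ≡ N /0 ⋆ M
[/0]-as-⋆ M N = subT-as-⋆ (N ∷ᵛ var) M

↦-map : {A B : Set} (f : A → B) (α : Fin m) (S : List A) → map f ∘ (α ↦ S) ≗ α ↦ map f S
↦-map f α S β with β ≟ α
... | yes _ = refl
... | no  _ = refl

↦-suc : {A : Set} (α : Fin m) (S : List A) → ([] ∷ᵛ (α ↦ S)) ≗ suc α ↦ S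
↦-suc α S zero = refl
↦-suc α S (suc β) with β ≟ α | suc β ≟ suc α
... | yes _  | yes _  = refl
... | no  _  | no  _  = refl
... | yes eq | no neq = ⊥-elim (neq (cong suc eq))
... | no neq | yes eq = ⊥-elim (neq (suc-injective eq))

⇑ᵛ-⇐ : (α : Fin m) (S : List (Term n m)) → ⇑ᵛ (α ⇐ S) ≐ α ⇐ map wkV S
⇑ᵛ-⇐ α S = (λ { zero → refl ; (suc x) → refl }) , (λ _ → refl) , ↦-map wkV α S

⇑ⁿ-⇐ : (α : Fin m) (S : List (Term n m)) → ⇑ⁿ (α ⇐ S) ≐ suc α ⇐ map wkN S
⇑ⁿ-⇐ α S =
  (λ _ → refl) , liftR-id ,
  λ β → ≡.trans (cong (map wkN) (↦-suc α S β)) (↦-map wkN (suc α) S β)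

mutual
  ssubT-as-⋆ : (α : Fin m) (L M : Term n m) → ssubT α L M ≡ α ⇐ [ L ] ⋆ M
  ssubT-as-⋆ α L (var x)   = refl
  ssubT-as-⋆ α L (lam M)   =
    cong lam (≡.trans (ssubT-as-⋆ α (wkV L) M) (sym (⋆-cong (⇑ᵛ-⇐ α [ L ]) M)))
  ssubT-as-⋆ α L (app M N) = cong₂ app (ssubT-as-⋆ α L M) (ssubT-as-⋆ α L N)
  ssubT-as-⋆ α L (mu C)    =
    cong mu (≡.trans (ssubC-as-⋆ᶜ (suc α) (wkN L) C) (sym (⋆ᶜ-cong (⇑ⁿ-⇐ α [ L ]) C)))

  ssubC-as-⋆ᶜ : (α : Fin m) (L : Term n m) (C : Cmd n m) → ssubC α L C ≡ α ⇐ [ L ] ⋆ᶜ C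
  ssubC-as-⋆ᶜ α L (cmd β M) with β ≟ α
  ... | yes _ = cong (λ P → cmd β (app P L)) (ssubT-as-⋆ α L M)
  ... | no  _ = cong (cmd β) (ssubT-as-⋆ α L M)

/0-wkV : (N M : Term n m) → N /0 ⋆ wkV M ≡ M
/0-wkV N M = ≡.trans (⋆-renT (N /0) suc id M) (ids-⋆ M)

⇐-wkN : (S : List (Term n (suc m))) (M : Term n m) → zero ⇐ S ⋆ wkN M ≡ wkN M
⇐-wkN S M = ≡.trans (⋆-renT (zero ⇐ S) id suc M) (sym (renT-as-⋆ id suc M))

⊙-/0 : (s : Sub n m n' m') (N : Term n m) → s ⊙ N /0 ≐ (s ⋆ N) ∷ᵗ s
⊙-/0 s N = (λ { zero → refl ; (suc x) → refl }) , (λ _ → refl) , (λ _ → refl)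

/0-⊙-⇑ᵛ : (N : Term n' m') (s : Sub n m n' m') → N /0 ⊙ ⇑ᵛ s ≐ N ∷ᵗ s
/0-⊙-⇑ᵛ N s =
  (λ { zero → refl ; (suc x) → /0-wkV N (terms s x) }) ,
  (λ _ → refl) ,
  λ α → ≡.trans (++-identityʳ _)
          (≡.trans (sym (map-∘ (stacks s α)))
                   (≡.trans (map-cong (/0-wkV N) (stacks s α)) (map-id (stacks s α))))

⇐-⊙-⇑ⁿ : (S : List (Term n' m')) (s : Sub n m n' m') → zero ⇐ map wkN S ⊙ ⇑ⁿ s ≐ S ∷ⁿ s
⇐-⊙-⇑ⁿ S s =
  ⇐-wkN (map wkN S) ∘ terms s ,
  (λ _ → refl) ,
  λ { zero → refl
    ; (suc α) → ≡.trans (++-identityʳ _)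
                  (≡.trans (sym (map-∘ (stacks s α))) (map-cong (⇐-wkN (map wkN S)) (stacks s α))) }

⇑ⁿ-⊙-⇐ : (s : Sub n m n' m') (S : List (Term n m)) → ⇑ⁿ s ⊙ zero ⇐ map wkN S ≐ map (s ⋆_) S ∷ⁿ s
⇑ⁿ-⊙-⇐ s S =
  (λ _ → refl) ,
  (λ _ → refl) ,
  λ { zero → ≡.trans (++-identityʳ _) (map-commute (⇑ⁿ-wkN s) S)
    ; (suc α) → refl }

⇐-⊙-⇐ : (S : List (Term n m)) (N : Term n m) →
        zero ⇐ map wkN S ⊙ zero ⇐ [ wkN N ] ≐ zero ⇐ map wkN (N ∷ S)
⇐-⊙-⇐ S N =
  (λ _ → refl) ,
  (λ _ → refl) ,
  λ { zero → cong (_∷ map wkN S) (⇐-wkN (map wkN S) N) ; (suc α) → refl }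

⇐-[] : zero ⇐ [] ≐ ids {n} {suc m}
⇐-[] = (λ _ → refl) , (λ _ → refl) , λ { zero → refl ; (suc β) → refl }

⇑ᵛ-[/0] : (s : Sub n m n' m') (M : Term (suc n) m) (N : Term n' m') → (⇑ᵛ s ⋆ M) [ N /0] ≡ N ∷ᵗ s ⋆ M
⇑ᵛ-[/0] s M N = begin
  (⇑ᵛ s ⋆ M) [ N /0]    ≡⟨ [/0]-as-⋆ (⇑ᵛ s ⋆ M) N ⟩
  N /0 ⋆ ⇑ᵛ s ⋆ M       ≡⟨ ⋆-⋆ (N /0) (⇑ᵛ s) M ⟩
  N /0 ⊙ ⇑ᵛ s ⋆ M       ≡⟨ ⋆-cong (/0-⊙-⇑ᵛ N s) M ⟩
  N ∷ᵗ s ⋆ M            ∎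
  where open ≡-Reasoning

⋆-[/0] : (s : Sub n m n' m') (M : Term (suc n) m) (N : Term n m) → s ⋆ M [ N /0] ≡ (⇑ᵛ s ⋆ M) [ s ⋆ N /0]
⋆-[/0] s M N = begin
  s ⋆ M [ N /0]           ≡⟨ cong (s ⋆_) ([/0]-as-⋆ M N) ⟩
  s ⋆ N /0 ⋆ M            ≡⟨ ⋆-⋆ s (N /0) M ⟩
  s ⊙ N /0 ⋆ M            ≡⟨ ⋆-cong (⊙-/0 s N) M ⟩
  (s ⋆ N) ∷ᵗ s ⋆ M        ≡⟨ ⇑ᵛ-[/0] s M (s ⋆ N) ⟨
  (⇑ᵛ s ⋆ M) [ s ⋆ N /0]  ∎
  where open ≡-Reasoning

⇐-⋆ᶜ-⇑ⁿ : (S : List (Term n' m')) (s : Sub n m n' m') (C : Cmd n (suc m)) →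
          zero ⇐ map wkN S ⋆ᶜ ⇑ⁿ s ⋆ᶜ C ≡ S ∷ⁿ s ⋆ᶜ C
⇐-⋆ᶜ-⇑ⁿ S s C = ≡.trans (⋆ᶜ-⋆ᶜ (zero ⇐ map wkN S) (⇑ⁿ s) C) (⋆ᶜ-cong (⇐-⊙-⇑ⁿ S s) C)

⇑ⁿ-⋆ᶜ-⇐ : (s : Sub n m n' m') (S : List (Term n m)) (C : Cmd n (suc m)) →
          ⇑ⁿ s ⋆ᶜ zero ⇐ map wkN S ⋆ᶜ C ≡ map (s ⋆_) S ∷ⁿ s ⋆ᶜ C
⇑ⁿ-⋆ᶜ-⇐ s S C = ≡.trans (⋆ᶜ-⋆ᶜ (⇑ⁿ s) (zero ⇐ map wkN S) C) (⋆ᶜ-cong (⇑ⁿ-⊙-⇐ s S) C)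

⋆ᶜ-ssubC : (s : Sub n m n' m') (N : Term n m) (C : Cmd n (suc m)) →
           ⇑ⁿ s ⋆ᶜ ssubC zero (wkN N) C ≡ ssubC zero (wkN (s ⋆ N)) (⇑ⁿ s ⋆ᶜ C)
⋆ᶜ-ssubC s N C = begin
  ⇑ⁿ s ⋆ᶜ ssubC zero (wkN N) C                ≡⟨ cong (⇑ⁿ s ⋆ᶜ_) (ssubC-as-⋆ᶜ zero (wkN N) C) ⟩
  ⇑ⁿ s ⋆ᶜ zero ⇐ map wkN [ N ] ⋆ᶜ C          ≡⟨ ⇑ⁿ-⋆ᶜ-⇐ s [ N ] C ⟩
  [ s ⋆ N ] ∷ⁿ s ⋆ᶜ C                         ≡⟨ ⇐-⋆ᶜ-⇑ⁿ [ s ⋆ N ] s C ⟨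
  zero ⇐ map wkN [ s ⋆ N ] ⋆ᶜ ⇑ⁿ s ⋆ᶜ C       ≡⟨ ssubC-as-⋆ᶜ zero (wkN (s ⋆ N)) (⇑ⁿ s ⋆ᶜ C) ⟨
  ssubC zero (wkN (s ⋆ N)) (⇑ⁿ s ⋆ᶜ C)        ∎
  where open ≡-Reasoning

·-congˡ : {H H' : Term n m} (S : List (Term n m)) → H ⟶ H' → (H · S) ⟶ (H' · S)
·-congˡ []      r = r
·-congˡ (N ∷ S) r = ·-congˡ S (ξ-appˡ r)

mutual
  ⋆-⟶ : (s : Sub n m n' m') {M M' : Term n m} → M ⟶ M' → (s ⋆ M) ⟶ (s ⋆ M')
  ⋆-⟶ s (β-red {M} {N}) = subst ((s ⋆ app (lam M) N) ⟶_) (sym (⋆-[/0] s M N)) β-red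
  ⋆-⟶ s (μ-red {C} {N}) = subst (λ C' → (s ⋆ app (mu C) N) ⟶ mu C') (sym (⋆ᶜ-ssubC s N C)) μ-red
  ⋆-⟶ s (ξ-lam r)       = ξ-lam (⋆-⟶ (⇑ᵛ s) r)
  ⋆-⟶ s (ξ-appˡ r)      = ξ-appˡ (⋆-⟶ s r)
  ⋆-⟶ s (ξ-appʳ r)      = ξ-appʳ (⋆-⟶ s r)
  ⋆-⟶ s (ξ-mu r)        = ξ-mu (⋆ᶜ-⟶ (⇑ⁿ s) r)

  ⋆ᶜ-⟶ : (s : Sub n m n' m') {C C' : Cmd n m} → C ⟶ᶜ C' → (s ⋆ᶜ C) ⟶ᶜ (s ⋆ᶜ C')
  ⋆ᶜ-⟶ s (ξ-cmd {α} r) = ξ-cmd (·-congˡ (stacks s α) (⋆-⟶ s r))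

renT-⟶ : (ρ : Fin n → Fin n') (τ : Fin m → Fin m') {M M' : Term n m} → M ⟶ M' → renT ρ τ M ⟶ renT ρ τ M'
renT-⟶ ρ τ {M} {M'} r = subst₂ _⟶_ (sym (renT-as-⋆ ρ τ M)) (sym (renT-as-⋆ ρ τ M')) (⋆-⟶ (ren ρ τ) r)

[/0]-⟶ : (N : Term n m) {M M' : Term (suc n) m} → M ⟶ M' → (M [ N /0]) ⟶ (M' [ N /0])
[/0]-⟶ N {M} {M'} r = subst₂ _⟶_ (sym ([/0]-as-⋆ M N)) (sym ([/0]-as-⋆ M' N)) (⋆-⟶ (N /0) r)

ssubC-⟶ : (α : Fin m) (L : Term n m) {C C' : Cmd n m} → C ⟶ᶜ C' → ssubC α L C ⟶ᶜ ssubC α L C'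
ssubC-⟶ α L {C} {C'} r =
  subst₂ _⟶ᶜ_ (sym (ssubC-as-⋆ᶜ α L C)) (sym (ssubC-as-⋆ᶜ α L C')) (⋆ᶜ-⟶ (α ⇐ [ L ]) r)

infix 4 _⟶*_ _⟶ₛ*_

_⟶*_ : Term n m → Term n m → Set
_⟶*_ = Star _⟶_

_⟶ₛ*_ : List (Term n m) → List (Term n m) → Set
_⟶ₛ*_ = Pointwise _⟶*_

map-⟶ₛ* : (f : Term n m → Term n' m') → (∀ {M M'} → M ⟶ M' → f M ⟶ f M') →
          {S S' : List (Term n m)} → S ⟶ₛ* S' → map f S ⟶ₛ* map f S'
map-⟶ₛ* f f-⟶ rs = Pointwise.map⁺ f f (Pointwise.map (gmap f f-⟶) rs)

app-⟶* : {M M' N N' : Term n m} → M ⟶* M' → N ⟶* N' → app M N ⟶* app M' N'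
app-⟶* {M' = M'} {N = N} rs rs' = gmap (λ P → app P N) ξ-appˡ rs ◅◅ gmap (app M') ξ-appʳ rs'

·-⟶* : {H H' : Term n m} {S S' : List (Term n m)} → H ⟶* H' → S ⟶ₛ* S' → (H · S) ⟶* (H' · S')
·-⟶* rs []          = rs
·-⟶* rs (rs' ∷ rss) = ·-⟶* (app-⟶* rs rs') rss

mutual
  ⋆-⟶* : {σ σ' : Fin n → Term n' m'} (η : Fin m → Fin m') {ς ς' : Fin m → List (Term n' m')} →
         (∀ x → σ x ⟶* σ' x) → (∀ α → ς α ⟶ₛ* ς' α) →
         (M : Term n m) → (⟪ σ , η , ς ⟫ ⋆ M) ⟶* (⟪ σ' , η , ς' ⟫ ⋆ M)
  ⋆-⟶* η rsᵗ rsˢ (var x)   = rsᵗ x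
  ⋆-⟶* η rsᵗ rsˢ (lam M)   =
    gmap lam ξ-lam (⋆-⟶* η (λ { zero → ε ; (suc x) → gmap wkV (renT-⟶ suc id) (rsᵗ x) })
                           (map-⟶ₛ* wkV (renT-⟶ suc id) ∘ rsˢ) M)
  ⋆-⟶* η rsᵗ rsˢ (app M N) = app-⟶* (⋆-⟶* η rsᵗ rsˢ M) (⋆-⟶* η rsᵗ rsˢ N)
  ⋆-⟶* η rsᵗ rsˢ (mu C)    =
    gmap mu ξ-mu (⋆ᶜ-⟶* (liftR η) (gmap wkN (renT-⟶ id suc) ∘ rsᵗ)
                        (λ { zero → [] ; (suc α) → map-⟶ₛ* wkN (renT-⟶ id suc) (rsˢ α) }) C)

  ⋆ᶜ-⟶* : {σ σ' : Fin n → Term n' m'} (η : Fin m → Fin m') {ς ς' : Fin m → List (Term n' m')} →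
          (∀ x → σ x ⟶* σ' x) → (∀ α → ς α ⟶ₛ* ς' α) →
          (C : Cmd n m) → Star _⟶ᶜ_ (⟪ σ , η , ς ⟫ ⋆ᶜ C) (⟪ σ' , η , ς' ⟫ ⋆ᶜ C)
  ⋆ᶜ-⟶* η rsᵗ rsˢ (cmd α M) = gmap (cmd (η α)) ξ-cmd (·-⟶* (⋆-⟶* η rsᵗ rsˢ M) (rsˢ α))

sn : Term n m → Set
sn = Acc (flip _⟶_)

sn-reflect : (f : Term n m → Term n' m') → (∀ {M M'} → M ⟶ M' → f M ⟶ f M') →
             {M : Term n m} → sn (f M) → sn M
sn-reflect f f-⟶ = Subrelation.accessible f-⟶ ∘ On.accessible f

sn-⟶* : {M M' : Term n m} → sn M → M ⟶* M' → sn M'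
sn-⟶* snM       ε        = snM
sn-⟶* (acc rs) (r ◅ rs*) = sn-⟶* (rs r) rs*

sn⇒SN : {M : Term n m} → sn M → SN M
sn⇒SN snM (f , f0≡M , steps) = go snM f f0≡M steps
  where
    go : {M : Term n m} → sn M → (f : ℕ → Term n m) → f 0 ≡ M → (∀ i → f i ⟶ f (suc i)) → ⊥
    go (acc rs) f refl steps = go (rs (steps 0)) (f ∘ suc) refl (steps ∘ suc)

sn-head : {H : Term n m} (S : List (Term n m)) → sn (H · S) → sn H
sn-head S = sn-reflect (_· S) (·-congˡ S)

sn-mu-cmd : (α : Fin (suc m)) {M : Term n (suc m)} → sn M → sn (mu (cmd α M))
sn-mu-cmd α (acc rs) = acc λ { (ξ-mu (ξ-cmd r)) → sn-mu-cmd α (rs r) }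

data VarHeaded {n m : ℕ} : Term n m → Set where
  varʰ : ∀ {x} → VarHeaded (var x)
  appʰ : ∀ {H N} → VarHeaded H → VarHeaded (app H N)

VarHeaded-⟶ : {H H' : Term n m} → VarHeaded H → H ⟶ H' → VarHeaded H'
VarHeaded-⟶ (appʰ h) (ξ-appˡ r) = appʰ (VarHeaded-⟶ h r)
VarHeaded-⟶ (appʰ h) (ξ-appʳ r) = appʰ h

sn-app-VarHeaded : {H N : Term n m} → VarHeaded H → sn H → sn N → sn (app H N)
sn-app-VarHeaded h (acc rsᴴ) (acc rsᴺ) = acc λ where
  (ξ-appˡ r) → sn-app-VarHeaded (VarHeaded-⟶ h r) (rsᴴ r) (acc rsᴺ)
  (ξ-appʳ r) → sn-app-VarHeaded h (acc rsᴴ) (rsᴺ r)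

sn-var· : (x : Fin n) (S : List (Term n m)) → All sn S → sn (var x · S)
sn-var· x S = go varʰ (acc λ ()) S
  where
    go : {H : Term n m} → VarHeaded H → sn H → (S : List (Term n m)) → All sn S → sn (H · S)
    go h snH []      []           = snH
    go h snH (N ∷ S) (snN ∷ snS) = go (appʰ h) (sn-app-VarHeaded h snH snN) S snS

infix 4 _⟶ₗ_

data _⟶ₗ_ {n m : ℕ} : List (Term n m) → List (Term n m) → Set where
  here  : ∀ {N N' S} → N ⟶ N' → (N ∷ S) ⟶ₗ (N' ∷ S)
  there : ∀ {N S S'} → S ⟶ₗ S' → (N ∷ S) ⟶ₗ (N ∷ S')

·-congʳ : (H : Term n m) {S S' : List (Term n m)} → S ⟶ₗ S' → (H · S) ⟶ (H · S')
·-congʳ H {N ∷ S} (here r)     = ·-congˡ S (ξ-appʳ r)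
·-congʳ H (there {N} rs)       = ·-congʳ (app H N) rs

data SpineStep {n m : ℕ} (H : Term n m) (S : List (Term n m)) : Term n m → Set where
  inHead  : ∀ {H'} → H ⟶ H' → SpineStep H S (H' · S)
  inStack : ∀ {S'} → S ⟶ₗ S' → SpineStep H S (H · S')

-- app P Q is neither an abstraction nor a μ, so no prefix of the spine is a redex.
app-spineStep : (P Q : Term n m) (S : List (Term n m)) {X : Term n m} →
                (app P Q · S) ⟶ X → SpineStep (app P Q) S X
app-spineStep P Q []      r = inHead r
app-spineStep P Q (N ∷ S) r with app-spineStep (app P Q) N S r
... | inHead (ξ-appˡ r') = inHead r'
... | inHead (ξ-appʳ r') = inStack (here r')
... | inStack rs         = inStack (there rs)

-- β and μ redexes app (head b) N are treated uniformly: `b` is the body under the binder,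
-- `fire b N` the contractum.
module HeadExpansion {n m : ℕ} {B : Set} (_⟶ᴮ_ : B → B → Set)
                     (head : B → Term n m) (fire : B → Term n m → Term n m) where

  data HeadStep (b : B) (N : Term n m) : Term n m → Set where
    fires  : HeadStep b N (fire b N)
    inBody : ∀ {b'} → b ⟶ᴮ b' → HeadStep b N (app (head b') N)
    inArg  : ∀ {N'} → N ⟶ N' → HeadStep b N (app (head b) N')

  module _ (headStep : ∀ {b N X} → app (head b) N ⟶ X → HeadStep b N X)
           (fire-⟶ᴮ : ∀ {b b' N} → b ⟶ᴮ b' → fire b N ⟶ fire b' N)
           (fire-⟶ : ∀ b {N N'} → N ⟶ N' → fire b N ⟶* fire b N') where

    -- Induction on sn N and, inside it, on sn (fire b N · S): a step in the body or the
    -- stack keeps the redex shape and makes the contractum spine step as well.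
    sn-expand : {b : B} {N : Term n m} (S : List (Term n m)) →
                sn N → sn (fire b N · S) → sn (app (head b) N · S)
    sn-expand {N = N} S (acc rsᴺ) = go S
      where
        go : {b : B} (S : List (Term n m)) → sn (fire b N · S) → sn (app (head b) N · S)
        go {b} S (acc rs) = acc λ r → step (app-spineStep (head b) N S r)
          where
            step : ∀ {X} → SpineStep (app (head b) N) S X → sn X
            step (inStack {S'} rs') = go {b} S' (rs (·-congʳ (fire b N) rs'))
            step (inHead r) with headStep r
            ... | fires     = acc rs
            ... | inBody r' = go S (rs (·-congˡ S (fire-⟶ᴮ r')))
            ... | inArg r'  = sn-expand S (rsᴺ r') (sn-⟶* (acc rs) (gmap (_· S) (·-congˡ S) (fire-⟶ b r')))

module β-Expansion {n m : ℕ} = HeadExpansion {n} {m} (_⟶_ {suc n} {m}) lam _[_/0]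

β-headStep : {M : Term (suc n) m} {N X : Term n m} → app (lam M) N ⟶ X → β-Expansion.HeadStep M N X
β-headStep β-red              = β-Expansion.fires
β-headStep (ξ-appˡ (ξ-lam r)) = β-Expansion.inBody r
β-headStep (ξ-appʳ r)         = β-Expansion.inArg r

[/0]-⟶* : (M : Term (suc n) m) {N N' : Term n m} → N ⟶ N' → (M [ N /0]) ⟶* (M [ N' /0])
[/0]-⟶* M {N} {N'} r =
  subst₂ _⟶*_ (sym ([/0]-as-⋆ M N)) (sym ([/0]-as-⋆ M N'))
    (⋆-⟶* id (λ { zero → r ◅ ε ; (suc x) → ε }) (λ _ → []) M)

sn-β-expand : {M : Term (suc n) m} {N : Term n m} (S : List (Term n m)) →
              sn N → sn (M [ N /0] · S) → sn (app (lam M) N · S)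
sn-β-expand = β-Expansion.sn-expand β-headStep ([/0]-⟶ _) [/0]-⟶*

μ-fire : Cmd n (suc m) → Term n m → Term n m
μ-fire C N = mu (ssubC zero (wkN N) C)

module μ-Expansion {n m : ℕ} = HeadExpansion {n} {m} (_⟶ᶜ_ {n} {suc m}) mu μ-fire

μ-headStep : {C : Cmd n (suc m)} {N X : Term n m} → app (mu C) N ⟶ X → μ-Expansion.HeadStep C N X
μ-headStep μ-red             = μ-Expansion.fires
μ-headStep (ξ-appˡ (ξ-mu r)) = μ-Expansion.inBody r
μ-headStep (ξ-appʳ r)        = μ-Expansion.inArg r

μ-fire-⟶* : (C : Cmd n (suc m)) {N N' : Term n m} → N ⟶ N' → μ-fire C N ⟶* μ-fire C N'
μ-fire-⟶* C {N} {N'} r =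
  subst₂ (λ C₁ C₂ → mu C₁ ⟶* mu C₂) (sym (ssubC-as-⋆ᶜ zero (wkN N) C)) (sym (ssubC-as-⋆ᶜ zero (wkN N') C))
    (gmap mu ξ-mu (⋆ᶜ-⟶* id (λ _ → ε) (λ { zero → (renT-⟶ id suc r ◅ ε) ∷ [] ; (suc β) → [] }) C))

sn-μ-expand₁ : {C : Cmd n (suc m)} {N : Term n m} (S : List (Term n m)) →
               sn N → sn (μ-fire C N · S) → sn (app (mu C) N · S)
sn-μ-expand₁ = μ-Expansion.sn-expand μ-headStep (ξ-mu ∘ ssubC-⟶ zero _) μ-fire-⟶*

sn-μ-expand : (S : List (Term n m)) (C : Cmd n (suc m)) →
              All sn S → sn (mu (zero ⇐ map wkN S ⋆ᶜ C)) → sn (mu C · S)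
sn-μ-expand []      C []          sn-fired =
  subst (sn ∘ mu) (≡.trans (⋆ᶜ-cong ⇐-[] C) (ids-⋆ᶜ C)) sn-fired
sn-μ-expand (N ∷ S) C (snN ∷ snS) sn-fired =
  sn-μ-expand₁ S snN (sn-μ-expand S (ssubC zero (wkN N) C) snS (subst (sn ∘ mu) stack-split sn-fired))
  where
    open ≡-Reasoning
    stack-split : zero ⇐ map wkN (N ∷ S) ⋆ᶜ C ≡ zero ⇐ map wkN S ⋆ᶜ ssubC zero (wkN N) C
    stack-split = sym (begin
      zero ⇐ map wkN S ⋆ᶜ ssubC zero (wkN N) C            ≡⟨ cong (zero ⇐ map wkN S ⋆ᶜ_) (ssubC-as-⋆ᶜ zero (wkN N) C) ⟩
      zero ⇐ map wkN S ⋆ᶜ zero ⇐ [ wkN N ] ⋆ᶜ C           ≡⟨ ⋆ᶜ-⋆ᶜ (zero ⇐ map wkN S) (zero ⇐ [ wkN N ]) C ⟩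
      zero ⇐ map wkN S ⊙ zero ⇐ [ wkN N ] ⋆ᶜ C            ≡⟨ ⋆ᶜ-cong (⇐-⊙-⇐ S N) C ⟩
      zero ⇐ map wkN (N ∷ S) ⋆ᶜ C                         ∎)

TermPred : Set₁
TermPred = ∀ {n m} → Term n m → Set

StackPred : Set₁
StackPred = ∀ {n m} → List (Term n m) → Set

-- Quantifying over all renamings, here and in _⇒SN, makes reducibility stable under the
-- weakenings performed when going under binders.
snʳ : TermPred
snʳ {n} {m} M = ∀ {n' m'} (ρ : Fin n → Fin n') (τ : Fin m → Fin m') → sn (renT ρ τ M)

infix 6 _⇒SN
infixr 5 _∷ᵖ_

_⇒SN : StackPred → TermPred
(P ⇒SN) {n} {m} M = ∀ {n' m'} (ρ : Fin n → Fin n') (τ : Fin m → Fin m') (S : List (Term n' m')) →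
                    P S → sn (renT ρ τ M · S)

_∷ᵖ_ : TermPred → StackPred → StackPred
(P ∷ᵖ Q) []      = ⊥
(P ∷ᵖ Q) (N ∷ S) = P N × Q S

-- ν and ω → ν get the same interpretation, as they are equivalent under ≤.
mutual
  ⟦_⟧ : TType → TermPred
  ⟦ ν ⟧        = All snʳ ⇒SN
  ⟦ ω⇒ν ⟧      = All snʳ ⇒SN
  ⟦ κ ⇒ν ⟧     = ⟦ κ ⟧ˢ ⇒SN
  ⟦ δ ∧ δ' ⟧ M = ⟦ δ ⟧ M × ⟦ δ' ⟧ M

  ⟦_⟧ˢ : SType → StackPred
  ⟦ δ ×ω ⟧ˢ      = ⟦ δ ⟧ ∷ᵖ All snʳ
  ⟦ δ ×ˢ κ ⟧ˢ    = ⟦ δ ⟧ ∷ᵖ ⟦ κ ⟧ˢ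
  ⟦ κ ∧ˢ κ' ⟧ˢ S = ⟦ κ ⟧ˢ S × ⟦ κ' ⟧ˢ S

⟦_⟧ᵀ : Tail → StackPred
⟦ ω ⟧ᵀ     = All snʳ
⟦ stk κ ⟧ᵀ = ⟦ κ ⟧ˢ

⟦arr⟧ : (κ : Tail) {M : Term n m} → ⟦ arr κ ⟧ M ⇔ (⟦ κ ⟧ᵀ ⇒SN) M
⟦arr⟧ ω       = mk⇔ id id
⟦arr⟧ (stk κ) = mk⇔ id id

⟦pair⇒ν⟧ : (κ : Tail) {δ : TType} {M : Term n m} → ⟦ pair δ κ ⇒ν ⟧ M ⇔ ((⟦ δ ⟧ ∷ᵖ ⟦ κ ⟧ᵀ) ⇒SN) M
⟦pair⇒ν⟧ ω       = mk⇔ id id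
⟦pair⇒ν⟧ (stk κ) = mk⇔ id id

snʳ-ren : (ρ : Fin n → Fin n') (τ : Fin m → Fin m') {M : Term n m} → snʳ M → snʳ (renT ρ τ M)
snʳ-ren ρ τ {M} snM ρ' τ' = subst sn (sym (renT-renT ρ' τ' ρ τ M)) (snM (ρ' ∘ ρ) (τ' ∘ τ))

snʳ⇒sn : {M : Term n m} → snʳ M → sn M
snʳ⇒sn {M = M} snM = subst sn (renT-id M) (snM id id)

snʳ-var : (x : Fin n) → snʳ {n} {m} (var x)
snʳ-var x ρ τ = acc λ ()

⇒SN-ren : {P : StackPred} (ρ : Fin n → Fin n') (τ : Fin m → Fin m') {M : Term n m} →
          (P ⇒SN) M → (P ⇒SN) (renT ρ τ M)
⇒SN-ren ρ τ {M} h ρ' τ' S p = subst (λ M' → sn (M' · S)) (sym (renT-renT ρ' τ' ρ τ M)) (h (ρ' ∘ ρ) (τ' ∘ τ) S p)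

⇒SN-elim : {P : StackPred} {M : Term n m} {S : List (Term n m)} → (P ⇒SN) M → P S → sn (M · S)
⇒SN-elim {M = M} {S} h p = subst (λ M' → sn (M' · S)) (renT-id M) (h id id S p)

⇒SN⇒sn : {P : StackPred} {M : Term n m} (S : List (Term (suc n) m)) → P S → (P ⇒SN) M → sn M
⇒SN⇒sn S p h = sn-reflect wkV (renT-⟶ suc id) (sn-head S (h suc id S p))

var-⇒SN : {P : StackPred} → (∀ {n m} {S : List (Term n m)} → P S → All sn S) →
          (x : Fin n) → (P ⇒SN) {n} {m} (var x)
var-⇒SN P⇒sn x ρ τ S p = sn-var· (ρ x) S (P⇒sn p)

⇒SN-app : {P : StackPred} {Q : TermPred} {M N : Term n m} →
          ((Q ∷ᵖ P) ⇒SN) M → (∀ {n' m'} (ρ : Fin n → Fin n') (τ : Fin m → Fin m') → Q (renT ρ τ N)) →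
          (P ⇒SN) (app M N)
⇒SN-app {N = N} h q ρ τ S p = h ρ τ (renT ρ τ N ∷ S) (q ρ τ , p)

mutual
  ⟦⟧-ren : (δ : TType) (ρ : Fin n → Fin n') (τ : Fin m → Fin m') {M : Term n m} → ⟦ δ ⟧ M → ⟦ δ ⟧ (renT ρ τ M)
  ⟦⟧-ren ν        ρ τ = ⇒SN-ren ρ τ
  ⟦⟧-ren ω⇒ν      ρ τ = ⇒SN-ren ρ τ
  ⟦⟧-ren (κ ⇒ν)   ρ τ = ⇒SN-ren ρ τ
  ⟦⟧-ren (δ ∧ δ') ρ τ (p , p') = ⟦⟧-ren δ ρ τ p , ⟦⟧-ren δ' ρ τ p'

  ⟦⟧ˢ-ren : (κ : SType) (ρ : Fin n → Fin n') (τ : Fin m → Fin m') {S : List (Term n m)} →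
            ⟦ κ ⟧ˢ S → ⟦ κ ⟧ˢ (map (renT ρ τ) S)
  ⟦⟧ˢ-ren (δ ×ω)    ρ τ {N ∷ S} (p , q) = ⟦⟧-ren δ ρ τ p , Allₚ.map⁺ (All.map (snʳ-ren ρ τ) q)
  ⟦⟧ˢ-ren (δ ×ˢ κ)  ρ τ {N ∷ S} (p , q) = ⟦⟧-ren δ ρ τ p , ⟦⟧ˢ-ren κ ρ τ q
  ⟦⟧ˢ-ren (κ ∧ˢ κ') ρ τ (q , q')        = ⟦⟧ˢ-ren κ ρ τ q , ⟦⟧ˢ-ren κ' ρ τ q'

arity : SType → ℕ
arity (δ ×ω)    = 1
arity (δ ×ˢ κ)  = suc (arity κ)
arity (κ ∧ˢ κ') = arity κ ⊔ arity κ'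

mutual
  ⟦⟧⇒sn : (δ : TType) {M : Term n m} → ⟦ δ ⟧ M → sn M
  ⟦⟧⇒sn ν        = ⇒SN⇒sn [] []
  ⟦⟧⇒sn ω⇒ν      = ⇒SN⇒sn [] []
  ⟦⟧⇒sn (κ ⇒ν)   = ⇒SN⇒sn (replicate (arity κ) (var zero)) (var-stack-⟦⟧ˢ κ zero ≤-refl)
  ⟦⟧⇒sn (δ ∧ δ') = ⟦⟧⇒sn δ ∘ proj₁

  var-⟦⟧ : (δ : TType) (x : Fin n) → ⟦ δ ⟧ {n} {m} (var x)
  var-⟦⟧ ν          = var-⇒SN (All.map snʳ⇒sn)
  var-⟦⟧ ω⇒ν        = var-⇒SN (All.map snʳ⇒sn)
  var-⟦⟧ (κ ⇒ν)     = var-⇒SN (⟦⟧ˢ⇒sn κ)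
  var-⟦⟧ (δ ∧ δ') x = var-⟦⟧ δ x , var-⟦⟧ δ' x

  ⟦⟧ˢ⇒sn : (κ : SType) {S : List (Term n m)} → ⟦ κ ⟧ˢ S → All sn S
  ⟦⟧ˢ⇒sn (δ ×ω)    {N ∷ S} (p , q) = ⟦⟧⇒sn δ p ∷ All.map snʳ⇒sn q
  ⟦⟧ˢ⇒sn (δ ×ˢ κ)  {N ∷ S} (p , q) = ⟦⟧⇒sn δ p ∷ ⟦⟧ˢ⇒sn κ q
  ⟦⟧ˢ⇒sn (κ ∧ˢ κ')                = ⟦⟧ˢ⇒sn κ ∘ proj₁

  var-stack-⟦⟧ˢ : (κ : SType) (x : Fin n) {k : ℕ} → arity κ ≤ k → ⟦ κ ⟧ˢ {n} {m} (replicate k (var x))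
  var-stack-⟦⟧ˢ (δ ×ω)    x {suc k} _       = var-⟦⟧ δ x , Allₚ.replicate⁺ k (snʳ-var x)
  var-stack-⟦⟧ˢ (δ ×ˢ κ)  x {suc k} (s≤s p) = var-⟦⟧ δ x , var-stack-⟦⟧ˢ κ x p
  var-stack-⟦⟧ˢ (κ ∧ˢ κ') x p =
    var-stack-⟦⟧ˢ κ x (m⊔n≤o⇒m≤o (arity κ) (arity κ') p) ,
    var-stack-⟦⟧ˢ κ' x (m⊔n≤o⇒n≤o (arity κ) (arity κ') p)

⟦⟧⇒snʳ : (δ : TType) {M : Term n m} → ⟦ δ ⟧ M → snʳ M
⟦⟧⇒snʳ δ p ρ τ = ⟦⟧⇒sn δ (⟦⟧-ren δ ρ τ p)

mutual
  ≤ᵗ-sound : {δ δ' : TType} → δ ≤ᵗ δ' → {M : Term n m} → ⟦ δ ⟧ M → ⟦ δ' ⟧ M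
  ≤ᵗ-sound refl         p       = p
  ≤ᵗ-sound (trans le le') p     = ≤ᵗ-sound le' (≤ᵗ-sound le p)
  ≤ᵗ-sound ∧-l          (p , _) = p
  ≤ᵗ-sound ∧-r          (_ , p) = p
  ≤ᵗ-sound ν≤ων         p       = p
  ≤ᵗ-sound ων≤ν         p       = p
  ≤ᵗ-sound (glb le le') p       = ≤ᵗ-sound le p , ≤ᵗ-sound le' p
  ≤ᵗ-sound (contra le)  p       = λ ρ τ S q → p ρ τ S (≤ˢ-sound le q)

  ≤ˢ-sound : {κ κ' : SType} → κ ≤ˢ κ' → {S : List (Term n m)} → ⟦ κ ⟧ˢ S → ⟦ κ' ⟧ˢ S
  ≤ˢ-sound refl                       q                     = q
  ≤ˢ-sound (trans le le')             q                     = ≤ˢ-sound le' (≤ˢ-sound le q)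
  ≤ˢ-sound ∧-l                        (q , _)               = q
  ≤ˢ-sound ∧-r                        (_ , q)               = q
  ≤ˢ-sound (drop {δ₂ = δ₂})           {N ∷ N' ∷ S} (p , p' , q) = p , ⟦⟧⇒snʳ δ₂ p' ∷ q
  ≤ˢ-sound dist-ω                     {N ∷ S} ((p , _) , p' , q) = (p , p') , q
  ≤ˢ-sound dist                       {N ∷ S} ((p , q) , p' , q') = (p , p') , q , q'
  ≤ˢ-sound (mono-ω le)                {N ∷ S} (p , q)       = ≤ᵗ-sound le p , q
  ≤ˢ-sound (mono le le')              {N ∷ S} (p , q)       = ≤ᵗ-sound le p , ≤ˢ-sound le' q
  ≤ˢ-sound (glb le le')               q                     = ≤ˢ-sound le q , ≤ˢ-sound le' q

infix 4 _⊨_∣_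

record _⊨_∣_ (s : Sub n m n' m') (Γ : Vector TType n) (Δ : Vector SType m) : Set where
  field
    ⊨terms  : ∀ x → ⟦ Γ x ⟧ (terms s x)
    ⊨stacks : ∀ α → ⟦ Δ α ⟧ˢ (stacks s α)

open _⊨_∣_

⟨⟩∘-⊨ : {s : Sub n m n' m'} {Γ : Vector TType n} {Δ : Vector SType m}
        (ρ : Fin n' → Fin n'') (τ : Fin m' → Fin m'') → s ⊨ Γ ∣ Δ → ⟨ ρ , τ ⟩∘ s ⊨ Γ ∣ Δ
⟨⟩∘-⊨ {Γ = Γ} {Δ} ρ τ ⊨s = record
  { ⊨terms  = λ x → ⟦⟧-ren (Γ x) ρ τ (⊨terms ⊨s x)
  ; ⊨stacks = λ α → ⟦⟧ˢ-ren (Δ α) ρ τ (⊨stacks ⊨s α) }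

∷ᵗ-⊨ : {s : Sub n m n' m'} {Γ : Vector TType n} {Δ : Vector SType m} {δ : TType} {N : Term n' m'} →
       ⟦ δ ⟧ N → s ⊨ Γ ∣ Δ → N ∷ᵗ s ⊨ δ ∷ᵛ Γ ∣ Δ
∷ᵗ-⊨ p ⊨s = record
  { ⊨terms  = λ { zero → p ; (suc x) → ⊨terms ⊨s x }
  ; ⊨stacks = ⊨stacks ⊨s }

∷ⁿ-⊨ : {s : Sub n m n' m'} {Γ : Vector TType n} {Δ : Vector SType m} {κ : SType} {S : List (Term n' m')} →
       ⟦ κ ⟧ˢ S → s ⊨ Γ ∣ Δ → S ∷ⁿ s ⊨ Γ ∣ κ ∷ᵛ Δ
∷ⁿ-⊨ {Γ = Γ} {Δ} {κ} p ⊨s = record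
  { ⊨terms  = λ x → ⟦⟧-ren (Γ x) id suc (⊨terms ⊨s x)
  ; ⊨stacks = λ { zero → ⟦⟧ˢ-ren κ id suc p ; (suc α) → ⟦⟧ˢ-ren (Δ α) id suc (⊨stacks ⊨s α) } }

⋆-lam-⇒SN : {P : StackPred} {Q : TermPred} (s : Sub n m n' m') (M : Term (suc n) m) →
            (∀ {n m} {N : Term n m} → Q N → sn N) →
            (∀ {n'' m''} (ρ : Fin n' → Fin n'') (τ : Fin m' → Fin m'') N S →
               Q N → P S → sn (N ∷ᵗ ⟨ ρ , τ ⟩∘ s ⋆ M · S)) →
            ((Q ∷ᵖ P) ⇒SN) (s ⋆ lam M)
⋆-lam-⇒SN s M Q⇒sn h ρ τ (N ∷ S) (q , p) =
  subst (λ L → sn (L · (N ∷ S))) (sym (renT-⋆ ρ τ s (lam M)))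
    (sn-β-expand S (Q⇒sn q)
      (subst (λ L → sn (L · S)) (sym (⇑ᵛ-[/0] (⟨ ρ , τ ⟩∘ s) M N)) (h ρ τ N S q p)))

⋆-mu-⇒SN : {P : StackPred} (s : Sub n m n' m') (C : Cmd n (suc m)) →
           (∀ {n m} {S : List (Term n m)} → P S → All sn S) →
           (∀ {n'' m''} (ρ : Fin n' → Fin n'') (τ : Fin m' → Fin m'') S →
              P S → sn (mu (S ∷ⁿ ⟨ ρ , τ ⟩∘ s ⋆ᶜ C))) →
           (P ⇒SN) (s ⋆ mu C)
⋆-mu-⇒SN s C P⇒sn h ρ τ S p =
  subst (λ L → sn (L · S)) (sym (renT-⋆ ρ τ s (mu C)))
    (sn-μ-expand S _ (P⇒sn p)
      (subst (sn ∘ mu) (sym (⇐-⋆ᶜ-⇑ⁿ S (⟨ ρ , τ ⟩∘ s) C)) (h ρ τ S p)))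

sn-mu-⋆ᶜ : {P : StackPred} (t : Sub n m n' (suc m')) (γ : Fin m) {M : Term n m} →
           (P ⇒SN) (t ⋆ M) → P (stacks t γ) → sn (mu (t ⋆ᶜ cmd γ M))
sn-mu-⋆ᶜ t γ h p = sn-mu-cmd (names t γ) (⇒SN-elim h p)

mutual
  fundamental : {Γ : Vector TType n} {Δ : Vector SType m} {M : Term n m} {δ : TType} →
                Γ ⊢ M ∶ δ ∣ Δ → (s : Sub n m n' m') → s ⊨ Γ ∣ Δ → ⟦ δ ⟧ (s ⋆ M)
  fundamental ax s ⊨s = ⊨terms ⊨s _
  fundamental (abs {M = M} {δ} κ ⊢M) s ⊨s =
    Equivalence.from (⟦pair⇒ν⟧ κ) (⋆-lam-⇒SN s M (⟦⟧⇒sn δ) λ ρ τ N S p q →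
      ⇒SN-elim (Equivalence.to (⟦arr⟧ κ) (fundamental ⊢M _ (∷ᵗ-⊨ p (⟨⟩∘-⊨ ρ τ ⊨s)))) q)
  fundamental (appT {δ = δ} κ ⊢M ⊢N) s ⊨s =
    Equivalence.from (⟦arr⟧ κ)
      (⇒SN-app (Equivalence.to (⟦pair⇒ν⟧ κ) (fundamental ⊢M s ⊨s))
               (λ ρ τ → ⟦⟧-ren δ ρ τ (fundamental ⊢N s ⊨s)))
  fundamental (μ-same ⊢M)   s ⊨s = fundamental-μ zero ⊢M s ⊨s
  fundamental (μ-diff β ⊢M) s ⊨s = fundamental-μ (suc β) ⊢M s ⊨s
  fundamental (sub ⊢M le)   s ⊨s = ≤ᵗ-sound le (fundamental ⊢M s ⊨s)
  fundamental (int ⊢M ⊢M')  s ⊨s = fundamental ⊢M s ⊨s , fundamental ⊢M' s ⊨s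

  fundamental-μ : {Γ : Vector TType n} {Δ : Vector SType m} {M : Term n (suc m)} {κ : SType}
                  (γ : Fin (suc m)) → Γ ⊢ M ∶ (κ ∷ᵛ Δ) γ ⇒ν ∣ (κ ∷ᵛ Δ) →
                  (s : Sub n m n' m') → s ⊨ Γ ∣ Δ → ⟦ κ ⇒ν ⟧ (s ⋆ mu (cmd γ M))
  fundamental-μ {M = M} {κ} γ ⊢M s ⊨s = ⋆-mu-⇒SN s (cmd γ M) (⟦⟧ˢ⇒sn κ) λ ρ τ S p →
    let t = S ∷ⁿ ⟨ ρ , τ ⟩∘ s
        ⊨t = ∷ⁿ-⊨ p (⟨⟩∘-⊨ ρ τ ⊨s)
    in sn-mu-⋆ᶜ t γ {M} (fundamental ⊢M t ⊨t) (⊨stacks ⊨t γ)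

theorem2p18 : ∀ {n m : ℕ} (Γ : Vector TType n) (Δ : Vector SType m)
                (M : Term n m) (δ : TType) →
                Γ ⊢ M ∶ δ ∣ Δ → SN M
theorem2p18 {n} {m} Γ Δ M δ ⊢M =
  sn⇒SN (sn-reflect (s₀ ⋆_) (⋆-⟶ s₀) (⟦⟧⇒sn δ (fundamental ⊢M s₀ ⊨s₀)))
  where
    -- Stacks in ⟦ Δ α ⟧ˢ cannot be empty, so the names receive stacks of a fresh variable.
    s₀ : Sub n m (suc n) m
    s₀ = ⟪ var ∘ suc , id , (λ α → replicate (arity (Δ α)) (var zero)) ⟫

    ⊨s₀ : s₀ ⊨ Γ ∣ Δ
    ⊨s₀ = record
      { ⊨terms  = λ x → var-⟦⟧ (Γ x) (suc x)
      ; ⊨stacks = λ α → var-stack-⟦⟧ˢ (Δ α) zero ≤-refl }
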